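{- Let $x\ge 0$, let $\vec\alpha_x=(\alpha_0,\ldots,\alpha_x)$ be strings, let $\vec n_x=(n_0,\ldots,n_x)$ be positive integers, and let $P$ be an open set of $(x+1)$-tuples of strings such that there is no $\vec n_x$-good system from $\vec\alpha_x$ for $P$. If $\vec V_x$ is an $\vec n_x$-good system from $\vec\alpha_x$, then there exists a tuple $\vec\beta_x$ such that $\vec\beta_x$ componentwise extends an element of $\vec V_x$ and there is no $\vec n_x$-good system from $\vec\beta_x$ for $P$.
   Context: A tree is a finite set of pairwise incomparable strings in $\omega^{<\omega}$. A nonempty tree $T$ is $a$-good from $\sigma$ if every $\tau\in T$ extends $\sigma$ and for each string $\tau$ with $\sigma\subseteq\tau\subsetneq\rho$ for some $\rho\in T$, at least $a$ immediate successors $\tau*k$ of $\tau$ are initial segments of elements of $T$. A system of trees $\vec T_x=(T_0,\ldots,T_x)$ consists of a tree $T_0$ and recursively, for each $k<x$ and each $\sigma_k\in T_k(\vec\sigma_{k-1})$, a tree $T_{k+1}(\vec\sigma_k)$, where $\vec\sigma_k=(\sigma_0,\ldots,\sigma_k)$ and $T_0(\vec\sigma_{ -1})=T_0$. Its elements are the tuples $\vec\sigma_x$ with $\sigma_k\in T_k(\vec\sigma_{k-1})$ for all $k\le x$. It is $\vec n_x$-good from $\vec\alpha_x$ if for every $k\le x$ and every element $\vec\beta_{k-1}$ of $(T_0,\ldots,T_{k-1})$, $T_k(\vec\beta_{k-1})$ is $n_k$-good from $\alpha_k$; it is for $P$ if all its elements lie in $P$. A tuple $\vec\xi_x$ componentwise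 extends $\vec\beta_x$ if $\xi_y$ extends $\beta_y$ for each $y\le x$. A set $P$ of $(x+1)$-tuples of strings is open if whenever $\vec\beta_x\in P$ and $\vec\xi_x$ componentwise extends $\vec\beta_x$, then $\vec\xi_x\in P$. -}

module Defs where

open import Data.Nat using (ℕ; zero; suc; _≤_)
open import Data.List using (List; []; _∷_; _++_; _∷ʳ_; length)
open import Data.List.Membership.Propositional using (_∈_)
open import Data.List.Relation.Unary.All using (All)
open import Data.List.Relation.Unary.AllPairs using (AllPairs)
open import Data.List.Relation.Unary.Unique.Propositional using (Unique)
open import Data.Vec using (Vec; []; _∷_)
open import Data.Vec.Relation.Binary.Pointwise.Inductive using (Pointwise)
open import Data.Product using (Σ; Σ-syntax; ∃; ∃-syntax; _×_; _,_)
open import Relation.Binary.PropositionalEquality using (_≡_)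
open import Relation.Nullary using (¬_)

String : Set
String = List ℕ

_⊑_ : String → String → Set
σ ⊑ τ = Σ[ ρ ∈ String ] σ ++ ρ ≡ τ

_⊏_ : String → String → Set
σ ⊏ τ = Σ[ k ∈ ℕ ] Σ[ ρ ∈ String ] σ ++ (k ∷ ρ) ≡ τ

Incomparable : String → String → Set
Incomparable σ τ = ¬ (σ ⊑ τ) × ¬ (τ ⊑ σ)

-- A tree: finite set of pairwise incomparable strings (represented as a list;
-- pairwise incomparability also rules out repetitions).
record Tree : Set where
  constructor mkTree
  field
    elems    : List String
    pairwise : AllPairs Incomparable elems
open Tree public

_∈T_ : String → Tree → Set
σ ∈T T = σ ∈ elems T

ManySuccessors : ℕ → String → Tree → Set
ManySuccessors a τ T =
  Σ[ ks ∈ List ℕ ] (a ≤ length ks × Unique ks ×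
     All (λ k → Σ[ ρ ∈ String ] (ρ ∈T T × (τ ∷ʳ k) ⊑ ρ)) ks)

IsGood : ℕ → String → Tree → Set
IsGood a σ T =
  (Σ[ ρ ∈ String ] ρ ∈T T)
  × (∀ τ → τ ∈T T → σ ⊑ τ)
  × (∀ τ ρ → ρ ∈T T → σ ⊑ τ → τ ⊏ ρ → ManySuccessors a τ T)

-- System of trees (T_0, …, T_x): a tree T_0, and for each σ_0 ∈ T_0 a system
-- (T_1(σ_0), …, T_x(σ_0, …)) of one less depth.
System : ℕ → Set
System zero    = Tree
System (suc x) = Σ[ T ∈ Tree ] ((σ : String) → σ ∈T T → System x)

Elem : ∀ {x} → System x → Vec String (suc x) → Set
Elem {zero}  T       (σ ∷ []) = σ ∈T T
Elem {suc x} (T , f) (σ ∷ τs) = Σ[ m ∈ σ ∈T T ] Elem (f σ m) τs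

GoodSystem : ∀ {x} → Vec ℕ (suc x) → Vec String (suc x) → System x → Set
GoodSystem {zero}  (n ∷ []) (α ∷ [])  T       = IsGood n α T
GoodSystem {suc x} (n ∷ ns) (α ∷ αs) (T , f) =
  IsGood n α T × (∀ σ (m : σ ∈T T) → GoodSystem ns αs (f σ m))

SystemFor : ∀ {x} → (Vec String (suc x) → Set) → System x → Set
SystemFor P S = ∀ σs → Elem S σs → P σs

CompExtends : ∀ {x} → Vec String (suc x) → Vec String (suc x) → Set
CompExtends ξs βs = Pointwise _⊑_ βs ξs

IsOpen : ∀ {x} → (Vec String (suc x) → Set) → Set
IsOpen {x} P = ∀ (βs ξs : Vec String (suc x)) → P βs → CompExtends ξs βs → P ξs

HasGoodSystemFor : ∀ {x} → Vec ℕ (suc x) → Vec String (suc x) → (Vec String (suc x) → Set) → Set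
HasGoodSystemFor {x} ns αs P = Σ[ S ∈ System x ] (GoodSystem ns αs S × SystemFor P S)

{-# OPTIONS --safe #-}
-- Say that P bars a tuple αs (with branching ns) if, coordinate by coordinate, either the current
-- string already leads into P or at least n of its immediate successors are barred. For positive
-- ns, good systems for P from αs are exactly the finite witnesses of such inductive bars. The
-- theorem is then a double-negated transitivity of bars: V bars αs, so if every tuple above an
-- element of V were ¬¬-barred by P, then αs would be ¬¬-barred by P. Transitivity is proved by
-- induction on the number of coordinates, turning the bar in the last coordinate into an open
-- predicate of the others. At a branching of that bar the bars above its finitely many successors
-- must be merged into one: for open predicates, being ¬¬-barred above a tuple is closed under
-- intersection, by transitivity one dimension lower.
module Submission where

open import Defs
open import Data.Nat using (ℕ; zero; suc; _≤_; s≤s⁻¹)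
open import Data.Nat.Properties using (≤-trans; ≤-reflexive; m≤n+m)
open import Data.List using (List; []; _∷_; _++_; _∷ʳ_; length; [_]; concat)
open import Data.List.Properties
  using ( ++-assoc; ++-identityʳ; ++-cancelˡ; ++-identityʳ-unique; ++-conicalʳ; length-++
        ; ∷-injectiveˡ)
open import Data.List.Extrema.Nat using (argmax; f[xs]≤f[argmax])
open import Data.List.Membership.Propositional using (_∈_; mapWith∈)
open import Data.List.Relation.Unary.Any using (here; there)
open import Data.List.Relation.Unary.Any.Properties as Any using (mapWith∈⁺; mapWith∈⁻)
open import Data.List.Relation.Unary.All as ListAll using ([]; _∷_)
open import Data.List.Relation.Unary.AllPairs using (AllPairs; []; _∷_)
import Data.List.Relation.Unary.AllPairs.Properties as AllPairs
open import Data.List.Relation.Unary.Unique.Propositional using (Unique)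
open import Data.Vec as Vec using (Vec; []; _∷_; initLast)
open import Data.Vec.Relation.Binary.Pointwise.Inductive as Pointwise using (Pointwise; []; _∷_)
open import Data.Vec.Relation.Unary.All using (All; []; _∷_)
open import Data.Product using (Σ-syntax; ∃₂; _×_; _,_; proj₁; proj₂; swap; uncurry)
open import Data.Sum using (_⊎_; inj₁; inj₂)
open import Function using (_∘_; id)
open import Function.Bundles using (_⇔_; mk⇔; Equivalence)
open import Level using (0ℓ)
open import Relation.Binary.PropositionalEquality
  using (_≡_; _≢_; refl; sym; trans; cong; subst; module ≡-Reasoning)
open import Relation.Nullary using (¬_; contradiction)
open import Relation.Nullary.Negation using (¬¬-map)
open import Relation.Unary using (Pred; _⊆_; _∩_)

open Equivalence using (to; from)

private variable
  d n k k′ : ℕ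
  σ τ ρ a : String
  ks : List ℕ
  T U : Tree

-- Strings

⊑-refl : σ ⊑ σ
⊑-refl = [] , ++-identityʳ _

-- Not matching on the equations keeps the extension of a composite equal to r ++ s by computation.
⊑-trans : σ ⊑ τ → τ ⊑ ρ → σ ⊑ ρ
⊑-trans {σ} (r , σr≡τ) (s , τs≡ρ) =
  r ++ s , trans (sym (++-assoc σ r s)) (trans (cong (_++ s) σr≡τ) τs≡ρ)

⊑-∷ʳ : σ ⊑ (σ ∷ʳ k)
⊑-∷ʳ {k = k} = [ k ] , refl

⊏⇒⊑ : σ ⊏ τ → σ ⊑ τ
⊏⇒⊑ (k , r , eq) = k ∷ r , eq

⊑⇒≡⊎∷ʳ⊑ : σ ⊑ τ → σ ≡ τ ⊎ Σ[ k ∈ ℕ ] (σ ∷ʳ k) ⊑ τ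
⊑⇒≡⊎∷ʳ⊑ {σ} ([] , eq) = inj₁ (trans (sym (++-identityʳ σ)) eq)
⊑⇒≡⊎∷ʳ⊑ {σ} (k ∷ r , eq) = inj₂ (k , r , trans (++-assoc σ [ k ] r) eq)

⊑-⊏-asym : σ ⊑ τ → ¬ τ ⊏ σ
⊑-⊏-asym {σ} σ⊑τ@(s , _) (k , r , τkr≡σ) =
  contradiction (++-conicalʳ s (k ∷ r) (++-identityʳ-unique σ (sym σskr≡σ))) λ ()
  where
  σskr≡σ : σ ++ s ++ k ∷ r ≡ σ
  σskr≡σ = proj₂ (⊑-trans σ⊑τ (k ∷ r , τkr≡σ))

∷ʳ-⊑-unique : (σ ∷ʳ k) ⊑ ρ → (σ ∷ʳ k′) ⊑ ρ → k ≡ k′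
∷ʳ-⊑-unique {σ} {k} {ρ} {k′} (r , σkr≡ρ) (r′ , σk′r′≡ρ) =
  ∷-injectiveˡ (++-cancelˡ σ (k ∷ r) (k′ ∷ r′) σkr≡σk′r′)
  where
  open ≡-Reasoning
  σkr≡σk′r′ : σ ++ k ∷ r ≡ σ ++ k′ ∷ r′
  σkr≡σk′r′ = begin
    σ ++ k ∷ r          ≡⟨ ++-assoc σ [ k ] r ⟨
    (σ ∷ʳ k) ++ r       ≡⟨ σkr≡ρ ⟩
    ρ                   ≡⟨ σk′r′≡ρ ⟨
    (σ ∷ʳ k′) ++ r′     ≡⟨ ++-assoc σ [ k′ ] r′ ⟩
    σ ++ k′ ∷ r′        ∎

∷ʳ-⊑-incomparable : k ≢ k′ → (σ ∷ʳ k) ⊑ τ → (σ ∷ʳ k′) ⊑ ρ → Incomparable τ ρ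
∷ʳ-⊑-incomparable k≢k′ σk⊑τ σk′⊑ρ =
  (λ τ⊑ρ → k≢k′ (∷ʳ-⊑-unique (⊑-trans σk⊑τ τ⊑ρ) σk′⊑ρ)) ,
  (λ ρ⊑τ → k≢k′ (∷ʳ-⊑-unique σk⊑τ (⊑-trans σk′⊑ρ ρ⊑τ)))

extension-length-≤ : (σ⊑τ : σ ⊑ τ) → length (proj₁ σ⊑τ) ≤ length τ
extension-length-≤ {σ} (r , refl) =
  ≤-trans (m≤n+m (length r) (length σ)) (≤-reflexive (sym (length-++ σ)))

-- Trees

Above : String → Tree → Set
Above σ T = ∀ τ → τ ∈T T → σ ⊑ τ

GoodTreeIn : ℕ → Pred String 0ℓ → String → Set
GoodTreeIn n A σ = Σ[ T ∈ Tree ] (IsGood n σ T × (∀ τ → τ ∈T T → A τ))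

manySuccessors-⊆ : (∀ {ρ} → ρ ∈T T → ρ ∈T U) → ManySuccessors n τ T → ManySuccessors n τ U
manySuccessors-⊆ T⊆U (ks , len , uniq , reach) =
  ks , len , uniq , ListAll.map (λ (ρ , ρ∈ , τk⊑ρ) → ρ , T⊆U ρ∈ , τk⊑ρ) reach

singleton : String → Tree
singleton σ = mkTree [ σ ] ([] ∷ [])

singleton-good : IsGood n σ (singleton σ)
singleton-good {σ = σ} =
  (σ , here refl) ,
  (λ { _ (here refl) → ⊑-refl }) ,
  (λ { _ _ (here refl) σ⊑τ τ⊏σ → contradiction τ⊏σ (⊑-⊏-asym σ⊑τ) })

⋃ : (ks : List ℕ) → (∀ {k} → k ∈ ks → Tree) → List String
⋃ ks T = concat (mapWith∈ ks (elems ∘ T))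

∈-⋃⁻ : ∀ ks (T : ∀ {k} → k ∈ ks → Tree) → τ ∈ ⋃ ks T → ∃₂ λ k (k∈ : k ∈ ks) → τ ∈T T k∈
∈-⋃⁻ ks T = mapWith∈⁻ ks (elems ∘ T) ∘ Any.concat⁻ (mapWith∈ ks (elems ∘ T))

∈-⋃⁺ : (T : ∀ {k} → k ∈ ks → Tree) (k∈ : k ∈ ks) → τ ∈T T k∈ → τ ∈ ⋃ ks T
∈-⋃⁺ T k∈ τ∈ = Any.concat⁺ (mapWith∈⁺ _ (_ , k∈ , τ∈))

⋃-pairwise : ∀ ks (T : ∀ {k} → k ∈ ks → Tree) → Unique ks →
             (∀ {k} (k∈ : k ∈ ks) → Above (σ ∷ʳ k) (T k∈)) →
             AllPairs Incomparable (⋃ ks T)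
⋃-pairwise [] T [] above = []
⋃-pairwise (k ∷ ks) T (k∉ks ∷ uniq) above =
  AllPairs.++⁺ (pairwise (T (here refl))) (⋃-pairwise ks (T ∘ there) uniq (above ∘ there))
    (ListAll.tabulate λ τ∈ → ListAll.tabulate λ ρ∈ →
      let k′ , k′∈ , ρ∈′ = ∈-⋃⁻ ks (T ∘ there) ρ∈ in
      ∷ʳ-⊑-incomparable (ListAll.lookup k∉ks k′∈)
        (above (here refl) _ τ∈) (above (there k′∈) _ ρ∈′))

⋃-good : (T : ∀ {k} → k ∈ ks → Tree) (pw : AllPairs Incomparable (⋃ ks T)) →
         n ≤ length ks → Unique ks → (∀ {k} (k∈ : k ∈ ks) → IsGood n (σ ∷ʳ k) (T k∈)) →
         k ∈ ks → IsGood n σ (mkTree (⋃ ks T) pw)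
⋃-good {ks = ks} {n} {σ} T pw len uniq good k₀∈ = inhabited , extends , branching
  where
  union : Tree
  union = mkTree (⋃ ks T) pw

  above : (k∈ : k ∈ ks) → Above (σ ∷ʳ k) (T k∈)
  above = proj₁ ∘ proj₂ ∘ good

  inhabited : Σ[ ρ ∈ String ] ρ ∈T union
  inhabited = let ρ , ρ∈ = proj₁ (good k₀∈) in ρ , ∈-⋃⁺ T k₀∈ ρ∈

  extends : Above σ union
  extends τ τ∈ = let k , k∈ , τ∈′ = ∈-⋃⁻ ks T τ∈ in ⊑-trans ⊑-∷ʳ (above k∈ τ τ∈′)

  branching : ∀ τ ρ → ρ ∈T union → σ ⊑ τ → τ ⊏ ρ → ManySuccessors n τ union
  branching τ ρ ρ∈ σ⊑τ τ⊏ρ with ⊑⇒≡⊎∷ʳ⊑ σ⊑τ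
  ... | inj₁ refl = ks , len , uniq , ListAll.tabulate λ k∈ →
    let ρ′ , ρ′∈ = proj₁ (good k∈) in ρ′ , ∈-⋃⁺ T k∈ ρ′∈ , above k∈ ρ′ ρ′∈
  ... | inj₂ (k′ , σk′⊑τ) with ∈-⋃⁻ ks T ρ∈
  ... | k , k∈ , ρ∈′ with ∷ʳ-⊑-unique (above k∈ ρ ρ∈′) (⊑-trans σk′⊑τ (⊏⇒⊑ τ⊏ρ))
  ... | refl = manySuccessors-⊆ {T = T k∈} {U = union} (∈-⋃⁺ T k∈)
                 (proj₂ (proj₂ (good k∈)) τ ρ ρ∈′ σk′⊑τ τ⊏ρ)

-- Bars

data Bar (n : ℕ) (A : Pred String 0ℓ) : Pred String 0ℓ where
  stop  : A σ → Bar n A σ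
  split : (ks : List ℕ) → n ≤ length ks → Unique ks →
          (∀ {k} → k ∈ ks → Bar n A (σ ∷ʳ k)) → Bar n A σ

private variable
  A B F : Pred String 0ℓ

bar-map : A ⊆ B → Bar n A ⊆ Bar n B
bar-map A⊆B (stop a) = stop (A⊆B a)
bar-map A⊆B (split ks len uniq next) = split ks len uniq (bar-map A⊆B ∘ next)

bar-∩ : (∀ {σ τ} → σ ⊑ τ → F σ → F τ) → F σ → Bar n A σ → Bar n (A ∩ F) σ
bar-∩ F-mono f (stop a) = stop (a , f)
bar-∩ F-mono f (split ks len uniq next) =
  split ks len uniq (bar-∩ F-mono (F-mono ⊑-∷ʳ f) ∘ next)

tree⇒bar : (T : Tree) → IsGood n σ T → (∀ τ → τ ∈T T → A τ) → Bar n A σ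
tree⇒bar {n} {σ} {A} T ((ρ , ρ∈) , above , many) into =
  barFrom (length (argmax length [] (elems T))) ⊑-refl ρ∈ (above ρ ρ∈) λ ρ∈ σ⊑ρ →
    ≤-trans (extension-length-≤ σ⊑ρ) (ListAll.lookup (f[xs]≤f[argmax] [] (elems T)) ρ∈)
  where
  barFrom : ∀ m {τ ρ} → σ ⊑ τ → ρ ∈T T → τ ⊑ ρ →
            (∀ {ρ} → ρ ∈T T → (τ⊑ρ : τ ⊑ ρ) → length (proj₁ τ⊑ρ) ≤ m) → Bar n A τ
  barFrom _ {τ} _ ρ∈ ([] , refl) _ = stop (into τ (subst (_∈T T) (++-identityʳ τ) ρ∈))
  barFrom zero _ ρ∈ (k ∷ r , eq) depth = contradiction (depth ρ∈ (k ∷ r , eq)) λ ()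
  barFrom (suc m) σ⊑τ ρ∈ (k ∷ r , eq) depth =
    let ks , len , uniq , reach = many _ _ ρ∈ σ⊑τ (k , r , eq) in
    split ks len uniq λ k∈ →
      let ρ′ , ρ′∈ , τk⊑ρ′ = ListAll.lookup reach k∈ in
      barFrom m (⊑-trans σ⊑τ ⊑-∷ʳ) ρ′∈ τk⊑ρ′ λ ρ∈ τk⊑ρ →
        s≤s⁻¹ (depth ρ∈ (⊑-trans ⊑-∷ʳ τk⊑ρ))

bar⇒tree : 1 ≤ n → Bar n A σ → GoodTreeIn n A σ
bar⇒tree _ (stop a) = singleton _ , singleton-good , λ { _ (here refl) → a }
bar⇒tree 1≤n (split [] len _ _) = contradiction (≤-trans 1≤n len) λ ()
bar⇒tree {n} {A} {σ} 1≤n (split ks@(_ ∷ _) len uniq next) =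
  mkTree (⋃ ks subtree) incomparable ,
  ⋃-good subtree incomparable len uniq good (here refl) ,
  into
  where
  child : (k∈ : k ∈ ks) → GoodTreeIn n A (σ ∷ʳ k)
  child k∈ = bar⇒tree 1≤n (next k∈)

  subtree : k ∈ ks → Tree
  subtree = proj₁ ∘ child

  good : (k∈ : k ∈ ks) → IsGood n (σ ∷ʳ k) (subtree k∈)
  good = proj₁ ∘ proj₂ ∘ child

  incomparable : AllPairs Incomparable (⋃ ks subtree)
  incomparable = ⋃-pairwise ks subtree uniq (proj₁ ∘ proj₂ ∘ good)

  into : ∀ τ → τ ∈ ⋃ ks subtree → A τ
  into τ τ∈ = let k , k∈ , τ∈′ = ∈-⋃⁻ ks subtree τ∈ in proj₂ (proj₂ (child k∈)) τ τ∈′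

-- Bars of tuples

_≼_ : Vec String d → Vec String d → Set
ps ≼ qs = Pointwise _⊑_ ps qs

≼-refl : {ps : Vec String d} → ps ≼ ps
≼-refl = Pointwise.refl ⊑-refl

≼-trans : {ps qs rs : Vec String d} → ps ≼ qs → qs ≼ rs → ps ≼ rs
≼-trans = Pointwise.trans ⊑-trans

≼-∷ʳ : {ps qs : Vec String d} → ps ≼ qs → σ ⊑ τ → (ps Vec.∷ʳ σ) ≼ (qs Vec.∷ʳ τ)
≼-∷ʳ [] σ⊑τ = σ⊑τ ∷ []
≼-∷ʳ (p⊑q ∷ ps≼qs) σ⊑τ = p⊑q ∷ ≼-∷ʳ ps≼qs σ⊑τ

Open : Pred (Vec String d) 0ℓ → Set
Open P = ∀ {ps qs} → ps ≼ qs → P ps → P qs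

private variable
  ns : Vec ℕ d
  αs : Vec String d
  P R E D₁ D₂ : Pred (Vec String d) 0ℓ

∩-open : Open D₁ → Open D₂ → Open (D₁ ∩ D₂)
∩-open open₁ open₂ ps≼qs (d₁ , d₂) = open₁ ps≼qs d₁ , open₂ ps≼qs d₂

Bars : Vec ℕ d → Pred (Vec String d) 0ℓ → Pred (Vec String d) 0ℓ
Bars [] P [] = P []
Bars (n ∷ ns) P (α ∷ αs) = Bar n (λ σ → Bars ns (P ∘ (σ ∷_)) αs) α

bars-map : ∀ ns → P ⊆ R → Bars ns P ⊆ Bars ns R
bars-map [] P⊆R {[]} = P⊆R
bars-map (n ∷ ns) P⊆R {α ∷ αs} = bar-map (bars-map ns P⊆R)

bars-universal : ∀ ns → (∀ {ps} → P ps) → Bars ns P αs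
bars-universal {αs = []} [] p = p
bars-universal {αs = α ∷ αs} (n ∷ ns) p = stop (bars-universal ns p)

bars-∩ : ∀ ns → Open E → E αs → Bars ns P αs → Bars ns (P ∩ E) αs
bars-∩ {αs = []} [] _ e b = b , e
bars-∩ {αs = α ∷ αs} (n ∷ ns) E-open e b =
  bar-map (λ (b , e) → bars-∩ ns (λ ps≼qs → E-open (⊑-refl ∷ ps≼qs)) e b)
    (bar-∩ (λ σ⊑τ → E-open (σ⊑τ ∷ ≼-refl)) e b)

system⇒bars : {ns : Vec ℕ (suc d)} {S : System d} →
              GoodSystem ns αs S → SystemFor P S → Bars ns P αs
system⇒bars {zero} {αs = _ ∷ []} {ns = _ ∷ []} {S = T} good for =
  tree⇒bar T good λ τ τ∈ → for (τ ∷ []) τ∈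
system⇒bars {suc d} {αs = _ ∷ _} {ns = _ ∷ _} {S = T , _} (good , goods) for =
  tree⇒bar T good λ τ τ∈ → system⇒bars (goods τ τ∈) λ τs e → for (τ ∷ τs) (τ∈ , e)

bars⇒system : {ns : Vec ℕ (suc d)} → All (1 ≤_) ns → Bars ns P αs → HasGoodSystemFor ns αs P
bars⇒system {zero} {αs = _ ∷ []} (1≤n ∷ []) b =
  let T , good , into = bar⇒tree 1≤n b in T , good , λ { (τ ∷ []) τ∈ → into τ τ∈ }
bars⇒system {suc d} {αs = _ ∷ _} (1≤n ∷ 1≤ns) b =
  let T , good , into = bar⇒tree 1≤n b
      subsystem = λ τ (τ∈ : τ ∈T T) → bars⇒system 1≤ns (into τ τ∈)
  in (T , λ τ τ∈ → proj₁ (subsystem τ τ∈)) ,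
     (good , λ τ τ∈ → proj₁ (proj₂ (subsystem τ τ∈))) ,
     λ { (τ ∷ τs) (τ∈ , e) → proj₂ (proj₂ (subsystem τ τ∈)) τs e }

-- Transitivity of bars

LastBar : ℕ → String → Pred (Vec String (suc d)) 0ℓ → Pred (Vec String d) 0ℓ
LastBar n a P ps = Bar n (P ∘ (ps Vec.∷ʳ_)) a

lastBar-open : Open P → Open (LastBar n a P)
lastBar-open P-open ps≼qs = bar-map (P-open (≼-∷ʳ ps≼qs ⊑-refl))

bars-∷ʳ : ∀ ns → Bars (ns Vec.∷ʳ n) P (αs Vec.∷ʳ a) ⇔ Bars ns (LastBar n a P) αs
bars-∷ʳ {αs = []} [] = mk⇔ id id
bars-∷ʳ {αs = α ∷ αs} (m ∷ ns) =
  mk⇔ (bar-map (to (bars-∷ʳ ns))) (bar-map (from (bars-∷ʳ ns)))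

BarredAbove : Vec ℕ d → Pred (Vec String d) 0ℓ → Pred (Vec String d) 0ℓ
BarredAbove ns P ps = ∀ {qs} → ps ≼ qs → ¬ ¬ Bars ns P qs

barredAbove-map : ∀ ns → P ⊆ R → BarredAbove ns P ⊆ BarredAbove ns R
barredAbove-map ns P⊆R barred ps≼qs = ¬¬-map (bars-map ns P⊆R) (barred ps≼qs)

barredAbove-open : ∀ ns → Open (BarredAbove ns P)
barredAbove-open _ ps≼qs barred qs≼rs = barred (≼-trans ps≼qs qs≼rs)

BarsTransitive : ℕ → Set₁
BarsTransitive d = ∀ (ns : Vec ℕ d) {E P} → Open E → Open P →
  (∀ {βs} → E βs → ¬ ¬ Bars ns P βs) → ∀ {αs} → Bars ns E αs → ¬ ¬ Bars ns P αs

barredAbove-∩ : BarsTransitive d → (ns : Vec ℕ d) → Open D₁ → Open D₂ →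
                BarredAbove ns D₁ αs → BarredAbove ns D₂ αs → BarredAbove ns (D₁ ∩ D₂) αs
barredAbove-∩ {D₁ = D₁} {D₂ = D₂} transitive ns open₁ open₂ barred₁ barred₂ αs≼qs ¬bars =
  barred₁ αs≼qs λ bars₁ →
    transitive ns (∩-open open₁ (barredAbove-open ns)) (∩-open open₁ open₂) complete
      (bars-∩ ns (barredAbove-open ns) (barredAbove-open ns αs≼qs barred₂) bars₁) ¬bars
  where
  complete : ∀ {βs} → (D₁ ∩ BarredAbove ns D₂) βs → ¬ ¬ Bars ns (D₁ ∩ D₂) βs
  complete (d₁ , barred₂′) = ¬¬-map (bars-map ns swap ∘ bars-∩ ns open₁ d₁) (barred₂′ ≼-refl)

barredAbove-All : BarsTransitive d → (ns : Vec ℕ d) {D : ℕ → Pred (Vec String d) 0ℓ} →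
                  (∀ k → Open (D k)) → (∀ {k} → k ∈ ks → BarredAbove ns (D k) αs) →
                  BarredAbove ns (λ qs → ListAll.All (λ k → D k qs) ks) αs
barredAbove-All {ks = []} _ ns _ _ _ ¬bars = ¬bars (bars-universal ns [])
barredAbove-All {ks = k ∷ ks} transitive ns D-open barred =
  barredAbove-map ns (uncurry _∷_)
    (barredAbove-∩ transitive ns (D-open k) (λ ps≼qs → ListAll.map (D-open _ ps≼qs))
      (barred (here refl)) (barredAbove-All transitive ns D-open (barred ∘ there)))

bars-transitive : ∀ d → BarsTransitive d
bars-transitive zero [] _ _ complete {[]} e = complete e
bars-transitive (suc d) ns {E} {P} E-open P-open complete {αs} bars
  with initLast ns | initLast αs
... | ns′ , n , refl | αs′ , a , refl =
  ¬¬-map (from (bars-∷ʳ ns′))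
    (bars-transitive d ns′ (lastBar-open E-open) (lastBar-open P-open)
      (λ e → barredAbove e ≼-refl) (to (bars-∷ʳ ns′) bars))
  where
  barredAbove : ∀ {a ps} → LastBar n a E ps → BarredAbove ns′ (LastBar n a P) ps
  barredAbove (stop e) ps≼qs =
    ¬¬-map (to (bars-∷ʳ ns′)) (complete (E-open (≼-∷ʳ ps≼qs ⊑-refl) e))
  barredAbove (split ks len uniq next) =
    barredAbove-map ns′ (split ks len uniq ∘ ListAll.lookup)
      (barredAbove-All (bars-transitive d) ns′ (λ _ → lastBar-open P-open) (barredAbove ∘ next))

lemma3p10 : (x : ℕ) (αs : Vec String (suc x)) (ns : Vec ℕ (suc x)) →
    All (λ n → 1 ≤ n) ns →
    (P : Vec String (suc x) → Set) → IsOpen P →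
    ¬ HasGoodSystemFor ns αs P →
    (V : System x) → GoodSystem ns αs V →
    ¬ ¬ (Σ[ βs ∈ Vec String (suc x) ]
          ((Σ[ γs ∈ Vec String (suc x) ] (Elem V γs × CompExtends βs γs))
           × ¬ HasGoodSystemFor ns βs P))
lemma3p10 x αs ns 1≤ns P P-open noSystem V goodV noβs =
  bars-transitive (suc x) ns aboveV-open (λ ps≼qs p → P-open _ _ p ps≼qs) barred
    (system⇒bars goodV λ γs γ∈V → γs , γ∈V , ≼-refl)
    (noSystem ∘ bars⇒system 1≤ns)
  where
  AboveV : Pred (Vec String (suc x)) 0ℓ
  AboveV βs = Σ[ γs ∈ Vec String (suc x) ] (Elem V γs × γs ≼ βs)

  aboveV-open : Open AboveV
  aboveV-open βs≼ξs (γs , γ∈V , γs≼βs) = γs , γ∈V , ≼-trans γs≼βs βs≼ξs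

  barred : ∀ {βs} → AboveV βs → ¬ ¬ Bars ns P βs
  barred aboveV ¬bars = noβs (_ , aboveV , λ (S , good , for) → ¬bars (system⇒bars good for))
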